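{- Let $r \geqslant 1$, $t \geqslant 2$ and $n \geqslant 1$ be integers, and let $\theta$ be the least positive integer such that $\lfloor n/(\theta+1) \rfloor < \lceil n/(\theta+r) \rceil$. Then $\chi^*_{r=}(K_{t(n)}) = t \lceil n/(\theta+r) \rceil$.
   Context: All graphs are finite, simple and undirected. $K_{t(n)}$ denotes the complete $t$-partite graph with all $t$ partite sets of size $n$: the vertex set is partitioned into independent sets $V_1,\ldots,V_t$ with $|V_i|=n$, every vertex of $V_i$ adjacent to every vertex of $V_j$ for $i \neq j$. For a positive integer $k$, a (proper) $k$-coloring of a graph $G=(V,E)$ is a map $f: V \to \{1,\ldots,k\}$ with $f(u)\neq f(v)$ whenever $uv \in E$; the color classes are the sets $\{u \in V : f(u)=c\}$ for $c=1,\ldots,k$, and these may be empty. For an integer $r \geqslant 0$, a $k$-coloring is $r$-equitable if the sizes of any two of its $k$ color classes (including empty ones) differ by at most $r$. The $r$-equitable chromatic threshold $\chi^*_{r=}(G)$ is the least positive integer $N$ such that $G$ has an $r$-equitable $k$-coloring for every integer $k \geqslant N$. -}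

module Defs where

open import Data.Nat using (ℕ; zero; suc; _+_; _*_; _∸_; _≤_; _<_)
open import Data.Nat.DivMod using (_/_)
open import Data.Fin using (Fin; quotient)
open import Data.Fin.Properties using (_≟_)
open import Data.List using (length; filter; allFin)
open import Data.Product using (Σ; _×_)
open import Relation.Binary.PropositionalEquality using (_≡_; _≢_)

record Graph : Set₁ where
  field
    V   : ℕ
    Adj : Fin V → Fin V → Set

open Graph public

-- K_{t(n)}: vertices Fin (t * n); vertex v lies in part (quotient n v) : Fin t
-- (parts are consecutive blocks of n vertices); adjacent iff in different parts.
K : ℕ → ℕ → Graph
K t n = record { V = t * n ; Adj = λ u v → quotient {t} n u ≢ quotient {t} n v }

IsProperColoring : (G : Graph) (k : ℕ) → (Fin (V G) → Fin k) → Set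
IsProperColoring G k f = ∀ u v → Adj G u v → f u ≢ f v

classSize : (G : Graph) (k : ℕ) → (Fin (V G) → Fin k) → Fin k → ℕ
classSize G k f c = length (filter (λ v → f v ≟ c) (allFin (V G)))

-- r-equitable: any two colour classes (including empty ones) differ by at most r
IsREquitable : (G : Graph) (r k : ℕ) → (Fin (V G) → Fin k) → Set
IsREquitable G r k f = ∀ c d → classSize G k f c ≤ classSize G k f d + r

HasREquitableColoring : Graph → ℕ → ℕ → Set
HasREquitableColoring G r k =
  Σ (Fin (V G) → Fin k) (λ f → IsProperColoring G k f × IsREquitable G r k f)

ColorableFrom : Graph → ℕ → ℕ → Set
ColorableFrom G r N = ∀ k → N ≤ k → HasREquitableColoring G r k

IsEquitableThreshold : Graph → ℕ → ℕ → Set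
IsEquitableThreshold G r N =
  1 ≤ N × ColorableFrom G r N × (∀ M → 1 ≤ M → ColorableFrom G r M → N ≤ M)

-- floor and ceiling division (only used with positive divisors; value 0 at divisor 0)
floorDiv : ℕ → ℕ → ℕ
floorDiv a zero    = 0
floorDiv a (suc b) = a / suc b

ceilDiv : ℕ → ℕ → ℕ
ceilDiv a zero    = 0
ceilDiv a (suc b) = (a + b) / suc b

ThetaCond : ℕ → ℕ → ℕ → Set
ThetaCond n r θ = floorDiv n (θ + 1) < ceilDiv n (θ + r)

IsLeastTheta : ℕ → ℕ → ℕ → Set
IsLeastTheta n r θ =
  1 ≤ θ × ThetaCond n r θ × (∀ θ' → 1 ≤ θ' → ThetaCond n r θ' → θ ≤ θ')

-- Write c = ⌈n/(θ+r)⌉. In a proper coloring of K_{t(n)} every color class lies inside one part,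
-- so a part is covered by the classes of the colors it uses.
-- Lower bound: take k = tc − 1 colors. If some class has at most θ vertices, all have at most
-- θ + r, and since the parts share at most k < tc colors, some part uses fewer than c of them and
-- so has at most (c − 1)(θ + r) < n vertices. Otherwise every class has more than θ vertices, each
-- part uses at most ⌊n/(θ+1)⌋ < c colors, and k ≤ t(c − 1) < tc − 1.
-- Upper bound: for k = s + qt ≥ tc with s < t, split each part into q or q + 1 residue classes.
-- All class sizes lie between ⌊n/(q+1)⌋ and ⌈n/q⌉, and minimality of θ gives
-- ⌈n/q⌉ ≤ ⌊n/(q+1)⌋ + r for every q ≥ c.

module Submission where

open import Defs
open import Data.Nat
  using (ℕ; zero; suc; pred; _+_; _*_; _≤_; _<_; z≤n; s≤s; s≤s⁻¹; NonZero; >-nonZero; >-nonZero⁻¹)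
  renaming (_≟_ to _≟ℕ_)
open import Data.Nat.Properties hiding (_≟_; suc-injective)
open import Data.Nat.DivMod
  using ( _/_; _%_; m/n*n≤m; m*n/n≡m; /-monoˡ-≤; m<n*o⇒m/o<n; m≡m%n+[m/n]*n; n/1≡n
        ; m%n<n; [m+n]%n≡m%n; m<n⇒m%n≡m; [m+kn]%n≡m%n)
open import Data.Fin using (Fin; zero; suc; toℕ; fromℕ<; _↑ˡ_; _↑ʳ_; combine; quotient; remainder)
open import Data.Fin.Properties
  using ( _≟_; suc-injective; toℕ-↑ˡ; toℕ-↑ʳ; toℕ<n; toℕ-fromℕ<; toℕ-injective; remQuot-combine
        ; any?; all?; ¬∀⟶∃¬)
open import Data.List using (length; filter; tabulate)
open import Data.Product using (∃; _,_; proj₁; proj₂)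
open import Data.Empty using (⊥)
open import Function using (_∘_; id)
open import Relation.Nullary using (Dec; yes; no; ¬_)
open import Relation.Nullary.Negation using (contradiction)
open import Relation.Unary using (Pred; Decidable)
open import Relation.Binary.PropositionalEquality
open import Level using (0ℓ)
open import Algebra.Properties.Semiring.Sum +-*-semiring
  using (sum-syntax; sum-cong-≗; sum-replicate-zero; ∑-comm; ∑-distrib-+; *-distribʳ-sum)

𝟙 : {P : Set} → Dec P → ℕ
𝟙 (yes _) = 1
𝟙 (no _)  = 0

𝟙≤1 : {P : Set} (p : Dec P) → 𝟙 p ≤ 1
𝟙≤1 (yes _) = s≤s z≤n
𝟙≤1 (no _)  = z≤n

𝟙-yes : {P : Set} (p : Dec P) → P → 𝟙 p ≡ 1
𝟙-yes (yes _) _ = refl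
𝟙-yes (no ¬p) p = contradiction p ¬p

𝟙-no : {P : Set} (p : Dec P) → ¬ P → 𝟙 p ≡ 0
𝟙-no (yes p) ¬p = contradiction p ¬p
𝟙-no (no _)  _  = refl

𝟙-pos : {P : Set} (p : Dec P) → 0 < 𝟙 p → P
𝟙-pos (yes p) _ = p

𝟙-cong : {P Q : Set} (p : Dec P) (q : Dec Q) → (P → Q) → (Q → P) → 𝟙 p ≡ 𝟙 q
𝟙-cong p (yes q) _ Q⇒P = 𝟙-yes p (Q⇒P q)
𝟙-cong p (no ¬q) P⇒Q _ = 𝟙-no p (¬q ∘ P⇒Q)

length-filter-tabulate : ∀ {A : Set} {P : Pred A 0ℓ} (P? : Decidable P) {m} (g : Fin m → A) →
  length (filter P? (tabulate g)) ≡ ∑[ i < m ] 𝟙 (P? (g i))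
length-filter-tabulate P? {zero}  g = refl
length-filter-tabulate P? {suc m} g with P? (g zero)
... | yes _ = cong suc (length-filter-tabulate P? (g ∘ suc))
... | no _  = length-filter-tabulate P? (g ∘ suc)

∑-const : ∀ m c → ∑[ i < m ] c ≡ m * c
∑-const zero    c = refl
∑-const (suc m) c = cong (c +_) (∑-const m c)

∑-zero : ∀ {m} (f : Fin m → ℕ) → (∀ i → f i ≡ 0) → ∑[ i < m ] f i ≡ 0
∑-zero {m} f f≡0 = trans (sum-cong-≗ f≡0) (sum-replicate-zero m)

∑-mono-≤ : ∀ {m} {f g : Fin m → ℕ} → (∀ i → f i ≤ g i) → ∑[ i < m ] f i ≤ ∑[ i < m ] g i
∑-mono-≤ {zero}  f≤g = z≤n
∑-mono-≤ {suc m} f≤g = +-mono-≤ (f≤g zero) (∑-mono-≤ (f≤g ∘ suc))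

term≤∑ : ∀ {m} (f : Fin m → ℕ) i → f i ≤ ∑[ j < m ] f j
term≤∑ f zero    = m≤m+n _ _
term≤∑ f (suc i) = ≤-trans (term≤∑ (f ∘ suc) i) (m≤n+m _ _)

∑-pos⇒∃pos : ∀ {m} (f : Fin m → ℕ) → 0 < ∑[ i < m ] f i → ∃ λ i → 0 < f i
∑-pos⇒∃pos {m} f 0<∑ with any? (λ i → 0 <? f i)
... | yes pos = pos
... | no ¬pos = contradiction (∑-zero f (λ i → n≤0⇒n≡0 (≮⇒≥ (¬pos ∘ (i ,_))))) (>⇒≢ 0<∑)

∑-single : ∀ {m} (f : Fin m → ℕ) i → (∀ j → j ≢ i → f j ≡ 0) → ∑[ j < m ] f j ≡ f i
∑-single f zero    f≡0 = trans (cong (f zero +_) (∑-zero (f ∘ suc) (λ j → f≡0 (suc j) (λ ())))) (+-identityʳ _)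
∑-single {suc m} f (suc i) f≡0 = trans (cong (_+ ∑[ j < m ] f (suc j)) (f≡0 zero (λ ())))
  (∑-single (f ∘ suc) i (λ j j≢i → f≡0 (suc j) (j≢i ∘ suc-injective)))

∑-↑ : ∀ a {b} (f : Fin (a + b) → ℕ) →
  ∑[ v < a + b ] f v ≡ ∑[ i < a ] f (i ↑ˡ b) + ∑[ j < b ] f (a ↑ʳ j)
∑-↑ zero    f = refl
∑-↑ (suc a) f = trans (cong (f zero +_) (∑-↑ a (f ∘ suc))) (sym (+-assoc (f zero) _ _))

∑-combine : ∀ t {n} (f : Fin (t * n) → ℕ) →
  ∑[ v < t * n ] f v ≡ ∑[ i < t ] ∑[ j < n ] f (combine i j)
∑-combine zero    f = refl
∑-combine (suc t) {n} f =
  trans (∑-↑ n f) (cong (∑[ j < n ] f (j ↑ˡ t * n) +_) (∑-combine t (f ∘ (n ↑ʳ_))))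

pigeonhole : ∀ {m} c (f : Fin m → ℕ) → ∑[ i < m ] f i < m * c → ∃ λ i → f i < c
pigeonhole {m} c f ∑<mc with all? (λ i → c ≤? f i)
... | no ¬all = let i , fi≱c = ¬∀⟶∃¬ m _ (λ i → c ≤? f i) ¬all in i , ≰⇒> fi≱c
... | yes all = contradiction (≤-trans (≤-reflexive (sym (∑-const m c))) (∑-mono-≤ all)) (<⇒≱ ∑<mc)

m+∑≤m*c : ∀ {m} (f : Fin m → ℕ) {c} → (∀ i → f i < c) → m + ∑[ i < m ] f i ≤ m * c
m+∑≤m*c {m} f {c} f<c = begin
  m + ∑[ i < m ] f i              ≡⟨ cong (_+ ∑[ i < m ] f i) (trans (sym (*-identityʳ m)) (sym (∑-const m 1))) ⟩
  ∑[ i < m ] 1 + ∑[ i < m ] f i   ≡⟨ ∑-distrib-+ (λ _ → 1) f ⟨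
  ∑[ i < m ] suc (f i)            ≤⟨ ∑-mono-≤ f<c ⟩
  ∑[ i < m ] c                    ≡⟨ ∑-const m c ⟩
  m * c                           ∎
  where open ≤-Reasoning

∣support∣ : ∀ {m} → (Fin m → ℕ) → ℕ
∣support∣ {m} f = ∑[ i < m ] 𝟙 (0 <? f i)

∑≤∣support∣* : ∀ {m} (f : Fin m → ℕ) {M} → (∀ i → 0 < f i → f i ≤ M) →
  ∑[ i < m ] f i ≤ ∣support∣ f * M
∑≤∣support∣* {m} f {M} f≤M = begin
  ∑[ i < m ] f i                   ≤⟨ ∑-mono-≤ (λ j → bound (f j) (0 <? f j) (f≤M j)) ⟩
  (∑[ i < m ] (𝟙 (0 <? f i) * M))   ≡⟨ *-distribʳ-sum M (λ i → 𝟙 (0 <? f i)) ⟨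
  ∣support∣ f * M                ∎
  where
  open ≤-Reasoning
  bound : ∀ x (x>0? : Dec (0 < x)) → (0 < x → x ≤ M) → x ≤ 𝟙 x>0? * M
  bound x (yes x>0) x≤M = ≤-trans (x≤M x>0) (≤-reflexive (sym (+-identityʳ M)))
  bound x (no x≯0)  _   = ≤-reflexive (n≤0⇒n≡0 (≮⇒≥ x≯0))

∣support∣*≤∑ : ∀ {m} (f : Fin m → ℕ) {L} → (∀ i → 0 < f i → L ≤ f i) →
  ∣support∣ f * L ≤ ∑[ i < m ] f i
∣support∣*≤∑ {m} f {L} L≤f = begin
  ∣support∣ f * L                ≡⟨ *-distribʳ-sum L (λ i → 𝟙 (0 <? f i)) ⟩
  (∑[ i < m ] (𝟙 (0 <? f i) * L))   ≤⟨ ∑-mono-≤ (λ j → bound (f j) (0 <? f j) (L≤f j)) ⟩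
  ∑[ i < m ] f i                   ∎
  where
  open ≤-Reasoning
  bound : ∀ x (x>0? : Dec (0 < x)) → (0 < x → L ≤ x) → 𝟙 x>0? * L ≤ x
  bound x (yes x>0) L≤x = ≤-trans (≤-reflexive (+-identityʳ L)) (L≤x x>0)
  bound x (no _)    _   = z≤n

∣support∣≤1 : ∀ {m} (f : Fin m → ℕ) → (∀ i j → 0 < f i → 0 < f j → i ≡ j) → ∣support∣ f ≤ 1
∣support∣≤1 f unique with any? (λ i → 0 <? f i)
... | yes (i , fi>0) = ≤-trans (≤-reflexive (∑-single _ i outside)) (𝟙≤1 (0 <? f i))
  where
  outside : ∀ j → j ≢ i → 𝟙 (0 <? f j) ≡ 0
  outside j j≢i = 𝟙-no (0 <? f j) (λ fj>0 → j≢i (unique j i fj>0 fi>0))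
... | no ¬pos = ≤-trans (≤-reflexive (∑-zero _ (λ i → 𝟙-no (0 <? f i) (¬pos ∘ (i ,_))))) z≤n

∑-pos⇒∣support∣-pos : ∀ {m} (f : Fin m → ℕ) → 0 < ∑[ i < m ] f i → 0 < ∣support∣ f
∑-pos⇒∣support∣-pos f ∑>0 =
  let i , fi>0 = ∑-pos⇒∃pos f ∑>0 in ≤-trans (≤-reflexive (sym (𝟙-yes (0 <? f i) fi>0))) (term≤∑ _ i)

≤floorDiv⇒*≤ : ∀ {n D x} → 0 < D → x ≤ floorDiv n D → x * D ≤ n
≤floorDiv⇒*≤ {n} {suc b} {x} _ x≤n/D = ≤-trans (*-monoˡ-≤ (suc b) x≤n/D) (m/n*n≤m n (suc b))

*≤⇒≤floorDiv : ∀ {n D x} → 0 < D → x * D ≤ n → x ≤ floorDiv n D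
*≤⇒≤floorDiv {n} {suc b} {x} _ xD≤n = ≤-trans (≤-reflexive (sym (m*n/n≡m x (suc b)))) (/-monoˡ-≤ (suc b) xD≤n)

*<⇒<ceilDiv : ∀ {n D y} → 0 < D → y * D < n → y < ceilDiv n D
*<⇒<ceilDiv {n} {suc b} {y} D>0 yD<n = *≤⇒≤floorDiv {n + b} D>0 (begin
  suc y * suc b         ≡⟨ +-comm (suc b) (y * suc b) ⟩
  y * suc b + suc b     ≡⟨ +-suc (y * suc b) b ⟩
  suc (y * suc b) + b   ≤⟨ +-monoˡ-≤ b yD<n ⟩
  n + b                 ∎)
  where open ≤-Reasoning

≤*⇒ceilDiv≤ : ∀ {n D y} → 0 < D → n ≤ y * D → ceilDiv n D ≤ y
≤*⇒ceilDiv≤ {n} {suc b} {y} _ n≤yD = s≤s⁻¹ (m<n*o⇒m/o<n (begin-strict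
  n + b               ≤⟨ +-monoˡ-≤ b n≤yD ⟩
  y * suc b + b       <⟨ +-monoʳ-< (y * suc b) (n<1+n b) ⟩
  y * suc b + suc b   ≡⟨ +-comm (y * suc b) (suc b) ⟩
  suc y * suc b       ∎))
  where open ≤-Reasoning

ceilDiv≤⇒≤* : ∀ {n D y} → 0 < D → ceilDiv n D ≤ y → n ≤ y * D
ceilDiv≤⇒≤* D>0 ⌈n/D⌉≤y = ≮⇒≥ (λ yD<n → <⇒≱ (*<⇒<ceilDiv D>0 yD<n) ⌈n/D⌉≤y)

<ceilDiv⇒*< : ∀ {n D y} → 0 < D → y < ceilDiv n D → y * D < n
<ceilDiv⇒*< D>0 y<⌈n/D⌉ = ≰⇒> (λ n≤yD → <⇒≱ y<⌈n/D⌉ (≤*⇒ceilDiv≤ D>0 n≤yD))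

floorDiv-antitone : ∀ {n D D'} → 0 < D → D ≤ D' → floorDiv n D' ≤ floorDiv n D
floorDiv-antitone {n} {D} {D'} D>0 D≤D' =
  *≤⇒≤floorDiv D>0 (≤-trans (*-monoʳ-≤ (floorDiv n D') D≤D') (≤floorDiv⇒*≤ (≤-trans D>0 D≤D') ≤-refl))

ceilDiv-antitone : ∀ {n D D'} → 0 < D → D ≤ D' → ceilDiv n D' ≤ ceilDiv n D
ceilDiv-antitone {n} {D} {D'} D>0 D≤D' =
  ≤*⇒ceilDiv≤ (≤-trans D>0 D≤D') (≤-trans (ceilDiv≤⇒≤* D>0 ≤-refl) (*-monoʳ-≤ (ceilDiv n D) D≤D'))

floorDiv≡/ : ∀ n D .{{_ : NonZero D}} → floorDiv n D ≡ n / D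
floorDiv≡/ n (suc _) = refl

*/+%≡ : ∀ n D .{{_ : NonZero D}} → n / D * D + n % D ≡ n
*/+%≡ n D = trans (+-comm (n / D * D) (n % D)) (sym (m≡m%n+[m/n]*n n D))

residueCount : (K : ℕ) .{{_ : NonZero K}} (e n : ℕ) → ℕ
residueCount K e n = ∑[ j < n ] 𝟙 (toℕ j % K ≟ℕ e)

∑𝟙toℕ≟ : ∀ b e → ∑[ j < b ] 𝟙 (toℕ j ≟ℕ e) ≡ 𝟙 (e <? b)
∑𝟙toℕ≟ b e with e <? b
... | yes e<b = trans (∑-single _ (fromℕ< e<b) (λ j j≢e → 𝟙-no (toℕ j ≟ℕ e)
                        (λ j≡e → j≢e (toℕ-injective (trans j≡e (sym (toℕ-fromℕ< e<b)))))))
                      (𝟙-yes (toℕ (fromℕ< e<b) ≟ℕ e) (toℕ-fromℕ< e<b))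
... | no e≮b  = ∑-zero _ (λ j → 𝟙-no (toℕ j ≟ℕ e) (λ j≡e → e≮b (subst (_< b) j≡e (toℕ<n j))))

residueCount-≤ : ∀ {K e b} .{{_ : NonZero K}} → b ≤ K → residueCount K e b ≡ 𝟙 (e <? b)
residueCount-≤ {K} {e} {b} b≤K = begin
  residueCount K e b            ≡⟨ sum-cong-≗ (λ j → cong (λ x → 𝟙 (x ≟ℕ e)) (toℕ%K≡toℕ j)) ⟩
  ∑[ j < b ] 𝟙 (toℕ j ≟ℕ e)     ≡⟨ ∑𝟙toℕ≟ b e ⟩
  𝟙 (e <? b)                    ∎
  where
  open ≡-Reasoning
  toℕ%K≡toℕ : (j : Fin b) → toℕ j % K ≡ toℕ j
  toℕ%K≡toℕ j = m<n⇒m%n≡m (≤-trans (toℕ<n j) b≤K)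

module _ {K e : ℕ} .{{_ : NonZero K}} (e<K : e < K) where

  residueCount-+K : ∀ m → residueCount K e (K + m) ≡ suc (residueCount K e m)
  residueCount-+K m = begin
    residueCount K e (K + m)                                ≡⟨ ∑-↑ K _ ⟩
    ∑[ i < K ] 𝟙 (toℕ (i ↑ˡ m) % K ≟ℕ e)
      + ∑[ j < m ] 𝟙 (toℕ (K ↑ʳ j) % K ≟ℕ e)               ≡⟨ cong₂ _+_ first-period shifted ⟩
    1 + residueCount K e m                                  ∎
    where
    open ≡-Reasoning
    first-period : ∑[ i < K ] 𝟙 (toℕ (i ↑ˡ m) % K ≟ℕ e) ≡ 1
    first-period = begin
      ∑[ i < K ] 𝟙 (toℕ (i ↑ˡ m) % K ≟ℕ e)
        ≡⟨ sum-cong-≗ {K} (λ i → cong (λ x → 𝟙 (x % K ≟ℕ e)) (toℕ-↑ˡ i m)) ⟩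
      residueCount K e K                     ≡⟨ residueCount-≤ ≤-refl ⟩
      𝟙 (e <? K)                             ≡⟨ 𝟙-yes (e <? K) e<K ⟩
      1                                      ∎
    shifted : ∑[ j < m ] 𝟙 (toℕ (K ↑ʳ j) % K ≟ℕ e) ≡ residueCount K e m
    shifted = sum-cong-≗ {m} (λ j → cong (λ x → 𝟙 (x ≟ℕ e))
      (trans (cong (_% K) (trans (toℕ-↑ʳ K j) (+-comm K (toℕ j)))) ([m+n]%n≡m%n (toℕ j) K)))

  residueCount-*+ : ∀ a {b} → b ≤ K → residueCount K e (a * K + b) ≡ a + 𝟙 (e <? b)
  residueCount-*+ zero    b≤K = residueCount-≤ b≤K
  residueCount-*+ (suc a) {b} b≤K = trans
    (cong (residueCount K e) (+-assoc K (a * K) b))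
    (trans (residueCount-+K (a * K + b)) (cong suc (residueCount-*+ a b≤K)))

  private
    K>0 : 0 < K
    K>0 = >-nonZero⁻¹ K

  floorDiv≤residueCount : ∀ n → floorDiv n K ≤ residueCount K e n
  floorDiv≤residueCount n = begin
    floorDiv n K                     ≡⟨ floorDiv≡/ n K ⟩
    n / K                            ≤⟨ m≤m+n (n / K) _ ⟩
    n / K + 𝟙 (e <? n % K)          ≡⟨ residueCount-*+ (n / K) (<⇒≤ (m%n<n n K)) ⟨
    residueCount K e (n / K * K + n % K)  ≡⟨ cong (residueCount K e) (*/+%≡ n K) ⟩
    residueCount K e n               ∎
    where open ≤-Reasoning

  residueCount≤ceilDiv : ∀ n → residueCount K e n ≤ ceilDiv n K
  residueCount≤ceilDiv n = subst (λ m → residueCount K e m ≤ ceilDiv m K) (*/+%≡ n K)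
    (≤-trans (≤-reflexive (residueCount-*+ a (<⇒≤ b<K))) (bound (e <? b)))
    where
    a b : ℕ
    a = n / K
    b = n % K
    b<K : b < K
    b<K = m%n<n n K
    bound : (e<b? : Dec (e < b)) → a + 𝟙 e<b? ≤ ceilDiv (a * K + b) K
    bound (yes e<b) = ≤-trans (≤-reflexive (+-comm a 1))
      (*<⇒<ceilDiv K>0 (m<m+n (a * K) (≤-trans (s≤s z≤n) e<b)))
    bound (no _) = ≤-trans (≤-reflexive (+-identityʳ a))
      (*-cancelʳ-≤ a _ K (≤-trans (m≤m+n (a * K) b) (ceilDiv≤⇒≤* K>0 ≤-refl)))

ceilDiv≤floorDiv-below-least : ∀ {n r θ θ'} → 0 < r → IsLeastTheta n r θ → θ' < θ →
  ceilDiv n (θ' + r) ≤ floorDiv n (θ' + 1)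
-- θ' = 0 is outside the range of the minimality hypothesis, but ⌈n/r⌉ ≤ n = ⌊n/1⌋ anyway.
ceilDiv≤floorDiv-below-least {n} {r} {θ' = zero} r>0 _ _ =
  ≤-trans (≤*⇒ceilDiv≤ r>0 (≤-trans (≤-reflexive (sym (*-identityʳ n))) (*-monoʳ-≤ n r>0)))
          (≤-reflexive (sym (n/1≡n n)))
ceilDiv≤floorDiv-below-least {θ' = suc θ'} _ (_ , _ , least) θ'<θ =
  ≮⇒≥ (λ cond → <⇒≱ θ'<θ (least (suc θ') (s≤s z≤n) cond))

ceilDiv≤floorDiv+r : ∀ {n r θ q} → 0 < r → IsLeastTheta n r θ → 0 < q →
  ceilDiv n (θ + r) ≤ q → ceilDiv n q ≤ floorDiv n (suc q) + r
-- For L = ⌊n/(q+1)⌋, L + r < ⌈n/q⌉ ≤ θ + r gives L < θ, and the θ-condition failing at L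
-- then forces L + 1 ≤ ⌊n/(q+1)⌋ = L.
ceilDiv≤floorDiv+r {n} {r} {θ} {q} r>0 least q>0 ⌈n/[θ+r]⌉≤q = ≮⇒≥ λ L+r<⌈n/q⌉ →
  let L<θ : L < θ
      L<θ = +-cancelʳ-< r L θ (≤-trans L+r<⌈n/q⌉ ⌈n/q⌉≤θ+r)
      q<⌈n/[L+r]⌉ : q < ceilDiv n (L + r)
      q<⌈n/[L+r]⌉ = *<⇒<ceilDiv L+r>0
        (≤-trans (≤-reflexive (cong suc (*-comm q (L + r)))) (<ceilDiv⇒*< q>0 L+r<⌈n/q⌉))
      [L+1][q+1]≤n : (L + 1) * suc q ≤ n
      [L+1][q+1]≤n = ≤-trans (≤-reflexive (*-comm (L + 1) (suc q)))
        (≤floorDiv⇒*≤ (+-monoˡ-≤ 1 z≤n) (≤-trans q<⌈n/[L+r]⌉ (ceilDiv≤floorDiv-below-least r>0 least L<θ)))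
  in <⇒≱ (≤-reflexive (+-comm 1 L)) (*≤⇒≤floorDiv (s≤s z≤n) [L+1][q+1]≤n)
  where
  L : ℕ
  L = floorDiv n (suc q)
  L+r>0 : 0 < L + r
  L+r>0 = ≤-trans r>0 (m≤n+m r L)
  θ+r>0 : 0 < θ + r
  θ+r>0 = ≤-trans r>0 (m≤n+m r θ)
  ⌈n/q⌉≤θ+r : ceilDiv n q ≤ θ + r
  ⌈n/q⌉≤θ+r = ≤*⇒ceilDiv≤ q>0 (begin
    n                             ≤⟨ ceilDiv≤⇒≤* θ+r>0 ≤-refl ⟩
    ceilDiv n (θ + r) * (θ + r)   ≤⟨ *-monoˡ-≤ (θ + r) ⌈n/[θ+r]⌉≤q ⟩
    q * (θ + r)                   ≡⟨ *-comm q (θ + r) ⟩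
    (θ + r) * q                   ∎)
    where open ≤-Reasoning

quotient-combine : ∀ {t} n (i : Fin t) (j : Fin n) → quotient {t} n (combine i j) ≡ i
quotient-combine n i j = cong proj₁ (remQuot-combine i j)

remainder-combine : ∀ {t} n (i : Fin t) (j : Fin n) → remainder {t} n (combine i j) ≡ j
remainder-combine n i j = cong proj₂ (remQuot-combine i j)

module PartSizes {t n k : ℕ} (f : Fin (t * n) → Fin k) where

  partSize : Fin t → Fin k → ℕ
  partSize i d = ∑[ j < n ] 𝟙 (f (combine i j) ≟ d)

  classSize≡∑partSize : ∀ d → classSize (K t n) k f d ≡ ∑[ i < t ] partSize i d
  classSize≡∑partSize d = trans (length-filter-tabulate (λ v → f v ≟ d) id) (∑-combine t _)

  ∑partSize≡n : ∀ i → ∑[ d < k ] partSize i d ≡ n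
  ∑partSize≡n i = begin
    ∑[ d < k ] partSize i d                         ≡⟨ ∑-comm (λ d j → 𝟙 (f (combine i j) ≟ d)) ⟩
    ∑[ j < n ] ∑[ d < k ] 𝟙 (f (combine i j) ≟ d)   ≡⟨ sum-cong-≗ (λ j → ∑𝟙≟ (f (combine i j))) ⟩
    ∑[ j < n ] 1                                    ≡⟨ ∑-const n 1 ⟩
    n * 1                                           ≡⟨ *-identityʳ n ⟩
    n                                               ∎
    where
    open ≡-Reasoning
    ∑𝟙≟ : ∀ c → ∑[ d < k ] 𝟙 (c ≟ d) ≡ 1
    ∑𝟙≟ c = trans (∑-single _ c (λ d d≢c → 𝟙-no (c ≟ d) (d≢c ∘ sym))) (𝟙-yes (c ≟ c) refl)

  partSize≤classSize : ∀ i d → partSize i d ≤ classSize (K t n) k f d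
  partSize≤classSize i d = ≤-trans (term≤∑ (λ i → partSize i d) i) (≤-reflexive (sym (classSize≡∑partSize d)))

  colorsUsed : Fin t → ℕ
  colorsUsed i = ∣support∣ (partSize i)

  ∑colorsUsed≡∑owners : ∑[ i < t ] colorsUsed i ≡ ∑[ d < k ] ∣support∣ (λ i → partSize i d)
  ∑colorsUsed≡∑owners = ∑-comm (λ i d → 𝟙 (0 <? partSize i d))

  n≤colorsUsed* : ∀ {M} → (∀ d → classSize (K t n) k f d ≤ M) → ∀ i → n ≤ colorsUsed i * M
  n≤colorsUsed* ≤M i = ≤-trans (≤-reflexive (sym (∑partSize≡n i)))
    (∑≤∣support∣* (partSize i) (λ d _ → ≤-trans (partSize≤classSize i d) (≤M d)))

  k≤∑colorsUsed : (∀ d → 0 < classSize (K t n) k f d) → k ≤ ∑[ i < t ] colorsUsed i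
  k≤∑colorsUsed nonempty = begin
    k                                           ≡⟨ *-identityʳ k ⟨
    k * 1                                       ≡⟨ ∑-const k 1 ⟨
    ∑[ d < k ] 1                                ≤⟨ ∑-mono-≤ (λ d → ∑-pos⇒∣support∣-pos (λ i → partSize i d)
                                                     (≤-trans (nonempty d) (≤-reflexive (classSize≡∑partSize d)))) ⟩
    ∑[ d < k ] ∣support∣ (λ i → partSize i d)   ≡⟨ ∑colorsUsed≡∑owners ⟨
    ∑[ i < t ] colorsUsed i                     ∎
    where open ≤-Reasoning

  module Proper (proper : IsProperColoring (K t n) k f) where

    partSize-unique : ∀ d i i' → 0 < partSize i d → 0 < partSize i' d → i ≡ i'
    partSize-unique d i i' pos pos' with i ≟ i'
    ... | yes i≡i' = i≡i'
    ... | no i≢i' =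
      let j  , fij>0   = ∑-pos⇒∃pos _ pos
          j' , fi'j'>0 = ∑-pos⇒∃pos _ pos'
      in contradiction
           (trans (𝟙-pos (f (combine i j) ≟ d) fij>0) (sym (𝟙-pos (f (combine i' j') ≟ d) fi'j'>0)))
           (proper (combine i j) (combine i' j')
             (λ q≡q' → i≢i' (trans (sym (quotient-combine n i j)) (trans q≡q' (quotient-combine n i' j')))))

    partSize≡classSize : ∀ i d → 0 < partSize i d → partSize i d ≡ classSize (K t n) k f d
    partSize≡classSize i d pos = sym (trans (classSize≡∑partSize d) (∑-single _ i (λ i' i'≢i →
      n≤0⇒n≡0 (≮⇒≥ (λ pos' → i'≢i (partSize-unique d i' i pos' pos))))))

    colorsUsed*≤n : ∀ {m} → (∀ d → m ≤ classSize (K t n) k f d) → ∀ i → colorsUsed i * m ≤ n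
    colorsUsed*≤n m≤ i = ≤-trans
      (∣support∣*≤∑ (partSize i) (λ d pos → ≤-trans (m≤ d) (≤-reflexive (sym (partSize≡classSize i d pos)))))
      (≤-reflexive (∑partSize≡n i))

    ∑colorsUsed≤k : ∑[ i < t ] colorsUsed i ≤ k
    ∑colorsUsed≤k = begin
      ∑[ i < t ] colorsUsed i                          ≡⟨ ∑colorsUsed≡∑owners ⟩
      ∑[ d < k ] ∣support∣ (λ i → partSize i d)        ≤⟨ ∑-mono-≤ (λ d → ∣support∣≤1 _ (partSize-unique d)) ⟩
      ∑[ d < k ] 1                                     ≡⟨ ∑-const k 1 ⟩
      k * 1                                            ≡⟨ *-identityʳ k ⟩
      k                                                ∎
      where open ≤-Reasoning

¬colorable-pred-t*ceilDiv : ∀ {r t n θ k} → 0 < r → 2 ≤ t → IsLeastTheta n r θ →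
  suc k ≡ t * ceilDiv n (θ + r) → ¬ HasREquitableColoring (K t n) r k
¬colorable-pred-t*ceilDiv {r} {t} {n} {θ} {k} r>0 t≥2 (_ , cond , _) k+1≡tc (f , proper , equitable) =
  refute (any? (λ d → size d ≤? θ))
  where
  open PartSizes {t} {n} f
  open Proper proper
  size : Fin k → ℕ
  size = classSize (K t n) k f
  c : ℕ
  c = ceilDiv n (θ + r)

  refute : Dec (∃ λ d → size d ≤ θ) → ⊥
  refute (yes (d₀ , size-d₀≤θ)) =
    let i , used<c = pigeonhole c colorsUsed (≤-trans (s≤s ∑colorsUsed≤k) (≤-reflexive k+1≡tc))
    in <⇒≱ (<ceilDiv⇒*< (≤-trans r>0 (m≤n+m r θ)) used<c)
           (n≤colorsUsed* (λ d → ≤-trans (equitable d d₀) (+-monoˡ-≤ r size-d₀≤θ)) i)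
  refute (no ¬small) = <⇒≱ t≥2 (+-cancelʳ-≤ k t 1 (begin
    t + k                        ≤⟨ +-monoʳ-≤ t (k≤∑colorsUsed (λ d → ≤-trans (s≤s z≤n) (θ<size d))) ⟩
    t + ∑[ i < t ] colorsUsed i  ≤⟨ m+∑≤m*c colorsUsed used<c ⟩
    t * c                        ≡⟨ k+1≡tc ⟨
    1 + k                        ∎))
    where
    open ≤-Reasoning
    θ<size : ∀ d → θ < size d
    θ<size d = ≰⇒> (¬small ∘ (d ,_))
    used<c : ∀ i → colorsUsed i < c
    used<c i = ≤-<-trans
      (*≤⇒≤floorDiv (+-monoˡ-≤ 1 z≤n)
        (colorsUsed*≤n (λ d → ≤-trans (≤-reflexive (+-comm θ 1)) (θ<size d)) i))
      cond

module BalancedColoring (n t₁ q₁ s : ℕ) (s<t : s < suc t₁) where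

  t q k : ℕ
  t = suc t₁
  q = suc q₁
  k = s + q * t

  blockSize : Fin t → ℕ
  blockSize o = q + 𝟙 (toℕ o <? s)

  colorOf : Fin t → ℕ → ℕ
  colorOf o j = toℕ o + (j % blockSize o) * t

  colorOf<k : ∀ o j → colorOf o j < k
  colorOf<k o j = bound (toℕ o <? s) (m%n<n j (blockSize o))
    where
    bound : (o<s? : Dec (toℕ o < s)) → ∀ {x} → x < q + 𝟙 o<s? → toℕ o + x * t < k
    bound (yes o<s) {x} x<q+1 = +-mono-<-≤ o<s (*-monoˡ-≤ t (s≤s⁻¹ (≤-trans x<q+1 (≤-reflexive (+-comm q 1)))))
    bound (no _)    {x} x<q+0 = begin-strict
      toℕ o + x * t    <⟨ +-mono-<-≤ (toℕ<n o) (*-monoˡ-≤ t (s≤s⁻¹ (≤-trans x<q+0 (≤-reflexive (+-identityʳ q))))) ⟩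
      t + q₁ * t       ≤⟨ m≤n+m (q * t) s ⟩
      k                ∎
      where open ≤-Reasoning

  colorOf%t : ∀ o j → colorOf o j % t ≡ toℕ o
  colorOf%t o j = trans ([m+kn]%n≡m%n (toℕ o) (j % blockSize o) t) (m<n⇒m%n≡m (toℕ<n o))

  coloring : Fin (t * n) → Fin k
  coloring v = fromℕ< (colorOf<k (quotient n v) (toℕ (remainder {t} n v)))

  toℕ-coloring : ∀ v → toℕ (coloring v) ≡ colorOf (quotient n v) (toℕ (remainder {t} n v))
  toℕ-coloring v = toℕ-fromℕ< _

  coloring%t : ∀ v → toℕ (coloring v) % t ≡ toℕ (quotient {t} n v)
  coloring%t v = trans (cong (_% t) (toℕ-coloring v)) (colorOf%t (quotient n v) (toℕ (remainder {t} n v)))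

  coloring-proper : IsProperColoring (K t n) k coloring
  coloring-proper u v different-parts same-color = different-parts (toℕ-injective
    (trans (sym (coloring%t u)) (trans (cong (λ c → toℕ c % t) same-color) (coloring%t v))))

  toℕ-coloring-combine : ∀ o j → toℕ (coloring (combine o j)) ≡ colorOf o (toℕ j)
  toℕ-coloring-combine o j = trans (toℕ-coloring (combine o j))
    (cong₂ (λ o' j' → colorOf o' (toℕ j')) (quotient-combine n o j) (remainder-combine n o j))

  partOf : Fin k → Fin t
  partOf d = fromℕ< (m%n<n (toℕ d) t)

  levelOf : Fin k → ℕ
  levelOf d = toℕ d / t

  toℕ≡part+level : ∀ d → toℕ d ≡ toℕ (partOf d) + levelOf d * t
  toℕ≡part+level d = trans (m≡m%n+[m/n]*n (toℕ d) t) (cong (_+ levelOf d * t) (sym (toℕ-fromℕ< _)))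

  levelOf<blockSize : ∀ d → levelOf d < blockSize (partOf d)
  levelOf<blockSize d = bound (toℕ (partOf d) <? s)
    where
    open ≤-Reasoning
    bound : (p<s? : Dec (toℕ (partOf d) < s)) → levelOf d < q + 𝟙 p<s?
    bound (yes _) = ≤-trans (*-cancelʳ-< t (levelOf d) (suc q) (begin-strict
      levelOf d * t                     ≤⟨ m≤n+m (levelOf d * t) (toℕ (partOf d)) ⟩
      toℕ (partOf d) + levelOf d * t    ≡⟨ toℕ≡part+level d ⟨
      toℕ d                             <⟨ toℕ<n d ⟩
      s + q * t                         ≤⟨ +-monoˡ-≤ (q * t) (<⇒≤ s<t) ⟩
      suc q * t                         ∎)) (≤-reflexive (+-comm 1 q))
    bound (no p≮s) = ≰⇒> λ q+0≤level → <⇒≱ (toℕ<n d) (begin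
      s + q * t                         ≤⟨ +-mono-≤ (≮⇒≥ p≮s) (*-monoˡ-≤ t (m+n≤o⇒m≤o q q+0≤level)) ⟩
      toℕ (partOf d) + levelOf d * t    ≡⟨ toℕ≡part+level d ⟨
      toℕ d                             ∎)

  color-determines-part : ∀ {o j d} → coloring (combine o j) ≡ d → o ≡ partOf d
  color-determines-part {o} {j} {d} refl = toℕ-injective (begin
    toℕ o                                  ≡⟨ cong toℕ (quotient-combine n o j) ⟨
    toℕ (quotient {t} n (combine o j))     ≡⟨ coloring%t (combine o j) ⟨
    toℕ d % t                              ≡⟨ toℕ-fromℕ< _ ⟨
    toℕ (partOf d)                         ∎)
    where open ≡-Reasoning

  open PartSizes {t} {n} coloring

  classSize≡residueCount : ∀ d →
    classSize (K t n) k coloring d ≡ residueCount (blockSize (partOf d)) (levelOf d) n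
  classSize≡residueCount d = begin
    classSize (K t n) k coloring d   ≡⟨ classSize≡∑partSize d ⟩
    ∑[ i < t ] partSize i d           ≡⟨ ∑-single (λ i → partSize i d) o (λ i i≢o →
                                           ∑-zero (λ j → 𝟙 (coloring (combine i j) ≟ d))
                                             (λ j → 𝟙-no (coloring (combine i j) ≟ d) (i≢o ∘ color-determines-part))) ⟩
    partSize o d                      ≡⟨ sum-cong-≗ {n} (λ j → 𝟙-cong _ (toℕ j % B ≟ℕ e) (level j) (color j)) ⟩
    residueCount B e n                ∎
    where
    open ≡-Reasoning
    o : Fin t
    o = partOf d
    B e : ℕ
    B = blockSize o
    e = levelOf d
    level : ∀ j → coloring (combine o j) ≡ d → toℕ j % B ≡ e
    level j c≡d = *-cancelʳ-≡ _ _ t (+-cancelˡ-≡ (toℕ o) _ _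
      (trans (sym (toℕ-coloring-combine o j)) (trans (cong toℕ c≡d) (toℕ≡part+level d))))
    color : ∀ j → toℕ j % B ≡ e → coloring (combine o j) ≡ d
    color j x≡e = toℕ-injective (trans (toℕ-coloring-combine o j)
      (trans (cong (λ x → toℕ o + x * t) x≡e) (sym (toℕ≡part+level d))))

  floorDiv≤classSize : ∀ d → floorDiv n (suc q) ≤ classSize (K t n) k coloring d
  floorDiv≤classSize d = begin
    floorDiv n (suc q)                               ≤⟨ floorDiv-antitone {n} (s≤s z≤n) blockSize≤suc-q ⟩
    floorDiv n (blockSize (partOf d))                ≤⟨ floorDiv≤residueCount (levelOf<blockSize d) n ⟩
    residueCount (blockSize (partOf d)) (levelOf d) n ≡⟨ classSize≡residueCount d ⟨
    classSize (K t n) k coloring d                  ∎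
    where
    open ≤-Reasoning
    blockSize≤suc-q : blockSize (partOf d) ≤ suc q
    blockSize≤suc-q = ≤-trans (+-monoʳ-≤ q (𝟙≤1 (toℕ (partOf d) <? s))) (≤-reflexive (+-comm q 1))

  classSize≤ceilDiv : ∀ d → classSize (K t n) k coloring d ≤ ceilDiv n q
  classSize≤ceilDiv d = begin
    classSize (K t n) k coloring d                  ≡⟨ classSize≡residueCount d ⟩
    residueCount (blockSize (partOf d)) (levelOf d) n ≤⟨ residueCount≤ceilDiv (levelOf<blockSize d) n ⟩
    ceilDiv n (blockSize (partOf d))                 ≤⟨ ceilDiv-antitone {n} (s≤s z≤n) (m≤m+n q _) ⟩
    ceilDiv n q                                      ∎
    where open ≤-Reasoning

  coloring-equitable : ∀ {r} → ceilDiv n q ≤ floorDiv n (suc q) + r → IsREquitable (K t n) r k coloring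
  coloring-equitable {r} ⌈n/q⌉≤⌊n/[q+1]⌋+r d d' =
    ≤-trans (classSize≤ceilDiv d) (≤-trans ⌈n/q⌉≤⌊n/[q+1]⌋+r (+-monoˡ-≤ r (floorDiv≤classSize d')))

colorableFrom-t*ceilDiv : ∀ {r t n θ} → 0 < r → 0 < t → 0 < n → IsLeastTheta n r θ →
  ColorableFrom (K t n) r (t * ceilDiv n (θ + r))
colorableFrom-t*ceilDiv {r} {suc t₁} {n} {θ} r>0 (s≤s z≤n) n>0 least k tc≤k =
  subst (HasREquitableColoring (K t n) r) (sym (m≡m%n+[m/n]*n k t))
    (colorable (k / t) (k % t) (m%n<n k t) (*≤⇒≤floorDiv (s≤s z≤n) (≤-trans (≤-reflexive (*-comm c t)) tc≤k)))
  where
  t c : ℕ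
  t = suc t₁
  c = ceilDiv n (θ + r)
  colorable : ∀ q s → s < t → c ≤ q → HasREquitableColoring (K t n) r (s + q * t)
  colorable zero     s _   c≤0 = contradiction c≤0 (<⇒≱ (*<⇒<ceilDiv (≤-trans r>0 (m≤n+m r θ)) n>0))
  colorable (suc q₁) s s<t c≤q =
    coloring , coloring-proper , coloring-equitable (ceilDiv≤floorDiv+r r>0 least (s≤s z≤n) c≤q)
    where open BalancedColoring n t₁ q₁ s s<t

corollary15 : (r t n θ : ℕ) → 1 ≤ r → 2 ≤ t → 1 ≤ n →
    IsLeastTheta n r θ →
    IsEquitableThreshold (K t n) r (t * ceilDiv n (θ + r))
corollary15 r t n θ r>0 t≥2 n>0 least = tc>0 , colorableFrom-t*ceilDiv r>0 t>0 n>0 least , least-threshold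
  where
  c : ℕ
  c = ceilDiv n (θ + r)
  t>0 : 0 < t
  t>0 = ≤-trans (s≤s z≤n) t≥2
  tc>0 : 0 < t * c
  tc>0 = *-mono-≤ t>0 (*<⇒<ceilDiv (≤-trans r>0 (m≤n+m r θ)) n>0)
  least-threshold : ∀ M → 1 ≤ M → ColorableFrom (K t n) r M → t * c ≤ M
  least-threshold M _ colorable = ≮⇒≥ λ M<tc →
    ¬colorable-pred-t*ceilDiv r>0 t≥2 least (suc-pred (t * c) {{>-nonZero tc>0}})
      (colorable (pred (t * c)) (<⇒≤pred M<tc))
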